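{- For every $k\geq2$ and $c\in\mathbb N$, $\psi_{k+1}(c[k\leftarrow k+1])=\psi_k c$.
   Context: For $a,b\in\mathbb N$ and $k\geq2$ define $A_a(k,b)$ by: $A_0(k,b)=k^b$; $A_{a+1}(k,0)=A_a^k(k,\cdot)(0)$; $A_{a+1}(k,b+1)=A_a^k(k,\cdot)(A_{a+1}(k,b))$, where $A_a^k(k,\cdot)$ denotes the $k$-fold composition of $x\mapsto A_a(k,x)$. For every $c>0$ there are unique $a,b,m,n\in\mathbb N$ such that $c=A_a(k,b)\cdot m+n$, $A_a(k,0)\leq c<A_{a+1}(k,0)$, $A_a(k,b)\leq c<A_a(k,b+1)$ and $n<A_a(k,b)$; this is the $k$-normal form of $c$, written $c=_{\rm NF}A_a(k,b)\cdot m+n$. The base change is defined by $0[k\leftarrow k+1]=0$ and, if $c=_{\rm NF}A_a(k,b)\cdot m+n$, $c[k\leftarrow k+1]=A_a(k+1,b[k\leftarrow k+1])\cdot m+n[k\leftarrow k+1]$. Let $\varepsilon_\xi$ enumerate the fixed points of $\xi\mapsto\omega^\xi$. For each $k\geq 2$ define $\psi_k\colon\mathbb N\to\varepsilon_\omega$ by $\psi_k 0=0$ and $\psi_k c=\omega^{\varepsilon_a+\psi_k b}\cdot m+\psi_k n$ if $c=_{\rm NF}A_a(k,b)\cdot m+n$ (normal form with respect to base $k$). -}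

module Defs where

open import Data.Nat using (ℕ; zero; suc; _+_; _*_; _^_; _≤_; _<_; compare; less; equal; greater)
open import Data.Product using (_×_)
open import Relation.Binary.PropositionalEquality using (_≡_)

iter : ℕ → (ℕ → ℕ) → ℕ → ℕ
iter zero    f x = x
iter (suc n) f x = f (iter n f x)

A : ℕ → ℕ → ℕ → ℕ
A zero    k b       = k ^ b
A (suc a) k zero    = iter k (A a k) 0
A (suc a) k (suc b) = iter k (A a k) (A (suc a) k b)

IsNF : (k c a b m n : ℕ) → Set
IsNF k c a b m n =
  (0 < c) ×
  (c ≡ A a k b * m + n) ×
  (A a k 0 ≤ c) × (c < A (suc a) k 0) ×
  (A a k b ≤ c) × (c < A a k (suc b)) ×
  (n < A a k b)

-- Base change c[k ← k+1], as the graph  BaseChange k c c'  (c' = c[k←k+1])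

data BaseChange (k : ℕ) : ℕ → ℕ → Set where
  bc-zero : BaseChange k 0 0
  bc-nf   : ∀ {c a b m n b' n'} → IsNF k c a b m n →
            BaseChange k b b' → BaseChange k n n' →
            BaseChange k c (A a (suc k) b' * m + n')

-- Ordinals below ε_ω in Cantor normal form (base ω).
--
-- An ordinal is 0 or  ω^e · (1+c) + r  with exponents strictly decreasing.
-- An exponent is either the atom ε_a, or an ordinal x (which is then never
-- itself an epsilon number; ε_a is represented as ω^(εₐ a)·1 + 0).
-- All operations below preserve this canonical form, so on the values
-- produced by them propositional equality is ordinal equality.

data Ord : Set
data Exp : Set

data Ord where
  𝟎      : Ord
  ω^_·suc_+_ : Exp → ℕ → Ord → Ord

data Exp where
  εₐ  : ℕ → Exp
  ord : Ord → Exp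

data Cmp : Set where
  lt eq gt : Cmp

cmpℕ : ℕ → ℕ → Cmp
cmpℕ m n with compare m n
... | less _ _    = lt
... | equal _     = eq
... | greater _ _ = gt

flipC : Cmp → Cmp
flipC lt = gt
flipC eq = eq
flipC gt = lt

cmpE   : Exp → Exp → Cmp
cmpO   : Ord → Ord → Cmp
-- cmpEps a x compares the ordinal x with ε_a
cmpEps : ℕ → Ord → Cmp
cmpEpsAux : Cmp → ℕ → Ord → Cmp

cmpE (εₐ a) (εₐ b) = cmpℕ a b
cmpE (εₐ a) (ord y) = flipC (cmpEps a y)
cmpE (ord x) (εₐ b) = cmpEps b x
cmpE (ord x) (ord y) = cmpO x y

cmpEps a 𝟎 = lt
cmpEps a (ω^ e ·suc c + r) = cmpEpsAux (cmpE e (εₐ a)) c r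

cmpEpsAux lt c r = lt
cmpEpsAux eq zero 𝟎 = eq
cmpEpsAux eq zero (ω^ _ ·suc _ + _) = gt
cmpEpsAux eq (suc c) r = gt
cmpEpsAux gt c r = gt

lexC : Cmp → Cmp → Cmp
lexC lt _ = lt
lexC eq d = d
lexC gt _ = gt

cmpO 𝟎 𝟎 = eq
cmpO 𝟎 (ω^ _ ·suc _ + _) = lt
cmpO (ω^ _ ·suc _ + _) 𝟎 = gt
cmpO (ω^ e ·suc c + r) (ω^ e' ·suc c' + r') =
  lexC (cmpE e e') (lexC (cmpℕ c c') (cmpO r r'))

infixl 6 _⊕_
_⊕_ : Ord → Ord → Ord
addAux : Cmp → Exp → ℕ → Ord → Ord → Ord

𝟎 ⊕ β = β
(ω^ e ·suc c + r) ⊕ 𝟎 = ω^ e ·suc c + r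
(ω^ e ·suc c + r) ⊕ (ω^ e' ·suc c' + r') =
  addAux (cmpE e e') e c r (ω^ e' ·suc c' + r')

addAux lt e c r β = β
addAux eq e c r 𝟎 = ω^ e ·suc c + r
addAux eq e c r (ω^ _ ·suc c' + r') = ω^ e ·suc (suc (c + c')) + r'
addAux gt e c r β = ω^ e ·suc c + (r ⊕ β)

infixl 7 _⊗ℕ_
_⊗ℕ_ : Ord → ℕ → Ord
α ⊗ℕ zero = 𝟎
𝟎 ⊗ℕ suc m = 𝟎
(ω^ e ·suc c + r) ⊗ℕ suc m = ω^ e ·suc (c + m * suc c) + r

ε : ℕ → Ord
ε a = ω^ εₐ a ·suc 0 + 𝟎

toExp : Ord → Exp
toExp (ω^ εₐ a ·suc zero + 𝟎) = εₐ a
toExp x = ord x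

ωexp : Ord → Ord
ωexp x = ω^ toExp x ·suc 0 + 𝟎

-- ψ_k : ℕ → ε_ω, as its graph  Psi k c α  (α = ψ_k c)

data Psi (k : ℕ) : ℕ → Ord → Set where
  ψ-zero : Psi k 0 𝟎
  ψ-nf   : ∀ {c a b m n β ν} → IsNF k c a b m n →
           Psi k b β → Psi k n ν →
           Psi k c (ωexp (ε a ⊕ β) ⊗ℕ m ⊕ ν)

-- The point is that c′ is again in (k+1)-normal form, with the
-- same a and m; then ψ_{k+1} c′ and ψ_k c are built from the same data and induction on c
-- finishes. By strong induction on c one shows simultaneously that c′ is in normal form, that
-- base change is increasing and strictly monotone, and that c < A_a^i(k,0) implies
-- c′ < A_a^i(k+1,0) for i ≤ k. Monotonicity holds because numbers in normal form are ordered
-- lexicographically by (a, b, m, n); the inequality c′ < A_a(k+1,b′+1) uses m < k when a = 0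
-- and z² ≤ A_a(k+1,z) otherwise.

module Submission where

open import Defs
open import Data.Nat using (ℕ; suc; _≤_)
open import Data.Product using (Σ; _×_)
open import Relation.Binary.PropositionalEquality using (_≡_)
open import Data.Nat using (zero; _+_; _*_; _^_; _<_; _≤?_; z≤n; s≤s; z<s)
open import Data.Nat.Properties
open import Data.Nat.DivMod using (_/_; _%_; m≡m%n+[m/n]*n; m%n<n)
open import Data.Nat.Induction using (<-rec)
open import Data.Nat.Tactic.RingSolver using (solve-∀)
open import Data.Product using (_,_; ∃-syntax)
open import Data.Sum using (inj₁; inj₂)
open import Data.Empty using (⊥-elim)
open import Relation.Binary.PropositionalEquality
  using (refl; sym; trans; cong; cong₂; subst; subst₂)
open import Relation.Nullary using (yes; no)
open import Relation.Binary.Definitions using (Monotonic₁; tri<; tri≈; tri>)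

private
  variable
    a b m n a′ b′ m′ n′ c c′ d d′ : ℕ

Inflationary : (ℕ → ℕ) → Set
Inflationary f = ∀ x → x < f x

module _ {f : ℕ → ℕ} where

  step⇒strictMono : (∀ x → f x < f (suc x)) → Monotonic₁ _<_ _<_ f
  step⇒strictMono step {x} {suc y} (s≤s x≤y) with m≤n⇒m<n∨m≡n x≤y
  ... | inj₁ x<y  = <-trans (step⇒strictMono step x<y) (step y)
  ... | inj₂ refl = step x

  step⇒inflationary : 0 < f 0 → (∀ x → f x < f (suc x)) → Inflationary f
  step⇒inflationary f0>0 step zero    = f0>0
  step⇒inflationary f0>0 step (suc x) = ≤-<-trans (step⇒inflationary f0>0 step x) (step x)

  strictMono⇒mono : Monotonic₁ _<_ _<_ f → Monotonic₁ _≤_ _≤_ f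
  strictMono⇒mono smono x≤y with m≤n⇒m<n∨m≡n x≤y
  ... | inj₁ x<y  = <⇒≤ (smono x<y)
  ... | inj₂ refl = ≤-refl

  mono⇒reflects-< : Monotonic₁ _≤_ _≤_ f → ∀ {x y} → f x < f y → x < y
  mono⇒reflects-< mono fx<fy = ≰⇒> (λ y≤x → <⇒≱ fx<fy (mono y≤x))

  ≤-iter : Inflationary f → ∀ n x → x ≤ iter n f x
  ≤-iter infl zero    x = ≤-refl
  ≤-iter infl (suc n) x = ≤-trans (≤-iter infl n x) (<⇒≤ (infl _))

  iter-inflationary : Inflationary f → ∀ {n} → 0 < n → Inflationary (iter n f)
  iter-inflationary infl {suc n} _ x = ≤-<-trans (≤-iter infl n x) (infl _)

  iter-monoˡ : Inflationary f → Monotonic₁ _≤_ _≤_ f →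
               ∀ {i j} → i ≤ j → ∀ x → iter i f x ≤ iter j f x
  iter-monoˡ infl mono {j = j} z≤n x = ≤-iter infl j x
  iter-monoˡ infl mono (s≤s i≤j)   x = mono (iter-monoˡ infl mono i≤j x)

iter-pointwise-≤ : ∀ {f g} → (∀ x → f x ≤ g x) → Monotonic₁ _≤_ _≤_ g →
                   ∀ n {x y} → x ≤ y → iter n f x ≤ iter n g y
iter-pointwise-≤ f≤g mono zero    x≤y = x≤y
iter-pointwise-≤ f≤g mono (suc n) x≤y = ≤-trans (f≤g _) (mono (iter-pointwise-≤ f≤g mono n x≤y))

-- Growth of A_a(k, ·)

module Growth {k : ℕ} (1<k : 1 < k) where

  0<k : 0 < k
  0<k = <-trans z<s 1<k

  A-step         : ∀ a x → A a k x < A a k (suc x)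
  A-inflationary : ∀ a → Inflationary (A a k)

  A-step zero    x = ^-monoʳ-< k 1<k (n<1+n x)
  A-step (suc a) x = iter-inflationary (A-inflationary a) 0<k (A (suc a) k x)

  A-inflationary zero    = step⇒inflationary z<s (A-step zero)
  A-inflationary (suc a) =
    step⇒inflationary (iter-inflationary (A-inflationary a) 0<k 0) (A-step (suc a))

  A-strictMono : ∀ a → Monotonic₁ _<_ _<_ (A a k)
  A-strictMono a = step⇒strictMono (A-step a)

  A-mono : ∀ a → Monotonic₁ _≤_ _≤_ (A a k)
  A-mono a = strictMono⇒mono (A-strictMono a)

  A-positive : ∀ a x → 0 < A a k x
  A-positive a x = ≤-<-trans z≤n (A-inflationary a x)

  -- A_{a+1}(k,0) = A_a^k(k,0) ≥ A_a^2(k,0) > A_a(k,0)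
  A-level-step : ∀ a → A a k 0 < A (suc a) k 0
  A-level-step a = <-≤-trans (A-strictMono a (A-positive a 0))
                             (iter-monoˡ (A-inflationary a) (A-mono a) 1<k 0)

  A-level-mono : Monotonic₁ _≤_ _≤_ (λ a → A a k 0)
  A-level-mono = strictMono⇒mono (step⇒strictMono A-level-step)

  <-A-level : ∀ a → a < A a k 0
  <-A-level = step⇒inflationary z<s A-level-step

  A-level-≤ : ∀ a x → A a k x ≤ A (suc a) k x
  A-level-≤ a zero    = <⇒≤ (A-level-step a)
  A-level-≤ a (suc x) = ≤-trans (A-mono a (A-inflationary (suc a) x))
                                (iter-monoˡ (A-inflationary a) (A-mono a) 0<k (A (suc a) k x))

  ^≤A : ∀ a x → k ^ x ≤ A a k x
  ^≤A zero    x = ≤-refl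
  ^≤A (suc a) x = ≤-trans (^≤A a x) (A-level-≤ a x)

A-monoˡ-base      : ∀ {k} → 1 < k → ∀ a x → A a k x ≤ A a (suc k) x
iter-A-monoˡ-base : ∀ {k} → 1 < k → ∀ a {y y′} → y ≤ y′ →
                    iter k (A a k) y ≤ iter (suc k) (A a (suc k)) y′

A-monoˡ-base 1<k zero    x       = ^-monoˡ-≤ x (n≤1+n _)
A-monoˡ-base 1<k (suc a) zero    = iter-A-monoˡ-base 1<k a z≤n
A-monoˡ-base 1<k (suc a) (suc x) = iter-A-monoˡ-base 1<k a (A-monoˡ-base 1<k (suc a) x)

iter-A-monoˡ-base {k} 1<k a y≤y′ =
  ≤-trans (iter-pointwise-≤ (A-monoˡ-base 1<k a) (G⁺.A-mono a) k y≤y′) (<⇒≤ (G⁺.A-inflationary a _))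
  where module G⁺ = Growth (m<n⇒m<1+n 1<k)

[1+n]*[1+n]≡n*n+[n+[1+n]] : ∀ n → suc n * suc n ≡ n * n + (n + suc n)
[1+n]*[1+n]≡n*n+[n+[1+n]] = solve-∀

n+[n+n]≡3*n : ∀ n → n + (n + n) ≡ 3 * n
n+[n+n]≡3*n = solve-∀

n*n≤3^n : ∀ n → n * n ≤ 3 ^ n
n*n≤3^n zero    = z≤n
n*n≤3^n (suc n) = begin
  suc n * suc n        ≡⟨ [1+n]*[1+n]≡n*n+[n+[1+n]] n ⟩
  n * n + (n + suc n)  ≤⟨ +-mono-≤ (n*n≤3^n n) (+-mono-≤ (<⇒≤ n<3^n) n<3^n) ⟩
  3 ^ n + (3 ^ n + 3 ^ n) ≡⟨ n+[n+n]≡3*n (3 ^ n) ⟩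
  3 ^ suc n            ∎
  where
  open ≤-Reasoning
  n<3^n : n < 3 ^ n
  n<3^n = Growth.A-inflationary {3} (s≤s (s≤s z≤n)) 0 n

A-square : ∀ {k} → 2 < k → ∀ a x → x * x ≤ A a k x
A-square 2<k a x =
  ≤-trans (n*n≤3^n x) (≤-trans (^-monoˡ-≤ x 2<k) (Growth.^≤A (<-trans (s≤s (s≤s z≤n)) 2<k) a x))

-- Normal forms

bracket : (f : ℕ → ℕ) → ∀ N {c} → f 0 ≤ c → c < f N → ∃[ i ] f i ≤ c × c < f (suc i)
bracket f zero    f0≤c c<fN = ⊥-elim (<⇒≱ c<fN f0≤c)
bracket f (suc N) {c} f0≤c c<fN with f N ≤? c
... | yes fN≤c = N , fN≤c , c<fN
... | no  fN≰c = bracket f N f0≤c (≰⇒> fN≰c)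

divMod : ∀ c x → 0 < x → ∃[ m ] ∃[ n ] c ≡ x * m + n × n < x
divMod c x@(suc _) _ =
  c / x , c % x ,
  trans (m≡m%n+[m/n]*n c x) (trans (+-comm (c % x) _) (cong (_+ c % x) (*-comm (c / x) x))) ,
  m%n<n c x

x≤x*m+r : ∀ x r → 0 < m → x ≤ x * m + r
x≤x*m+r {suc m} x r _ =
  ≤-trans (≤-trans (m≤m+n x (x * m)) (≤-reflexive (sym (*-suc x m)))) (m≤m+n _ r)

x<x*m+r : ∀ x {r} → 0 < m → 0 < r → x < x * m + r
x<x*m+r x 0<m 0<r = ≤-<-trans (x≤x*m+r x 0 0<m) (+-monoʳ-< (x * _) 0<r)

x*m+r<x*[1+m] : ∀ x m {r} → r < x → x * m + r < x * suc m
x*m+r<x*[1+m] x m r<x =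
  <-≤-trans (+-monoʳ-< (x * m) r<x) (≤-reflexive (trans (+-comm _ x) (sym (*-suc x m))))

data LexLess (a b m n a′ b′ m′ n′ : ℕ) : Set where
  level       : a < a′ → LexLess a b m n a′ b′ m′ n′
  exponent    : a ≡ a′ → b < b′ → LexLess a b m n a′ b′ m′ n′
  coefficient : a ≡ a′ → b ≡ b′ → m < m′ → LexLess a b m n a′ b′ m′ n′
  remainder   : a ≡ a′ → b ≡ b′ → m ≡ m′ → n < n′ → LexLess a b m n a′ b′ m′ n′

data LexOrdering (a b m n a′ b′ m′ n′ : ℕ) : Set where
  lex< : LexLess a b m n a′ b′ m′ n′ → LexOrdering a b m n a′ b′ m′ n′
  lex≡ : a ≡ a′ → b ≡ b′ → m ≡ m′ → n ≡ n′ → LexOrdering a b m n a′ b′ m′ n′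
  lex> : LexLess a′ b′ m′ n′ a b m n → LexOrdering a b m n a′ b′ m′ n′

lex-compare : ∀ a b m n a′ b′ m′ n′ → LexOrdering a b m n a′ b′ m′ n′
lex-compare a b m n a′ b′ m′ n′ with <-cmp a a′
... | tri< p _ _ = lex< (level p)
... | tri> _ _ p = lex> (level p)
... | tri≈ _ refl _ with <-cmp b b′
...   | tri< p _ _ = lex< (exponent refl p)
...   | tri> _ _ p = lex> (exponent refl p)
...   | tri≈ _ refl _ with <-cmp m m′
...     | tri< p _ _ = lex< (coefficient refl refl p)
...     | tri> _ _ p = lex> (coefficient refl refl p)
...     | tri≈ _ refl _ with <-cmp n n′
...       | tri< p _ _ = lex< (remainder refl refl refl p)
...       | tri> _ _ p = lex> (remainder refl refl refl p)
...       | tri≈ _ refl _ = lex≡ refl refl refl refl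

LexLess-map : ∀ {a₁ b₁ m₁ n₁ b₁′ n₁′} →
              (b₁ < b → b₁′ < b′) → (b₁ ≡ b → b₁′ ≡ b′) → (n₁ < n → n₁′ < n′) →
              LexLess a₁ b₁ m₁ n₁ a b m n → LexLess a₁ b₁′ m₁ n₁′ a b′ m n′
LexLess-map f g h (level p)              = level p
LexLess-map f g h (exponent e p)         = exponent e (f p)
LexLess-map f g h (coefficient e e′ p)   = coefficient e (g e′) p
LexLess-map f g h (remainder e e′ e″ p)  = remainder e (g e′) e″ (h p)

module NormalForm {k : ℕ} (1<k : 1 < k) where
  open Growth 1<k

  nf-exists : 0 < c → ∃[ a ] ∃[ b ] ∃[ m ] ∃[ n ] IsNF k c a b m n
  nf-exists {c} 0<c with bracket (λ a → A a k 0) c 0<c (<-A-level c)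
  ... | a , Aa0≤c , c<Asa0 with bracket (A a k) c Aa0≤c (A-inflationary a c)
  ... | b , Ab≤c , c<Asb with divMod c (A a k b) (A-positive a b)
  ... | m , n , c≡ , n< = a , b , m , n , 0<c , c≡ , Aa0≤c , c<Asa0 , Ab≤c , c<Asb , n<

  nf-b< : IsNF k c a b m n → b < c
  nf-b< {a = a} {b} (_ , _ , _ , _ , Ab≤c , _) = <-≤-trans (A-inflationary a b) Ab≤c

  nf-n< : IsNF k c a b m n → n < c
  nf-n< (_ , _ , _ , _ , Ab≤c , _ , n<Ab) = <-≤-trans n<Ab Ab≤c

  nf-m>0 : IsNF k c a b m n → 0 < m
  nf-m>0 {m = suc m} _ = z<s
  nf-m>0 {a = a} {b} {zero} {n} (_ , c≡ , _ , _ , Ab≤c , _ , n<Ab) =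
    ⊥-elim (<⇒≱ n<Ab (subst (A a k b ≤_) (trans c≡ (cong (_+ n) (*-zeroʳ (A a k b)))) Ab≤c))

  nf-m≤ : IsNF k c a b m n → m ≤ c
  nf-m≤ {c} {a} {b} {m} {n} (_ , c≡ , _) = begin
    m             ≡⟨ sym (*-identityˡ m) ⟩
    1 * m         ≤⟨ *-monoˡ-≤ m (A-positive a b) ⟩
    A a k b * m   ≤⟨ m≤m+n _ n ⟩
    A a k b * m + n ≡⟨ sym c≡ ⟩
    c             ∎
    where open ≤-Reasoning

  nf-leading : IsNF k c a b m n → IsNF k (A a k b) a b 1 0
  nf-leading {a = a} {b} (_ , _ , _ , c<Asa0 , Ab≤c , _) =
    A-positive a b , sym (trans (+-identityʳ _) (*-identityʳ _)) , A-mono a z≤n ,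
    ≤-<-trans Ab≤c c<Asa0 , ≤-refl , A-step a b , A-positive a b

  LexLess⇒< : IsNF k c a b m n → IsNF k c′ a′ b′ m′ n′ → LexLess a b m n a′ b′ m′ n′ → c < c′
  LexLess⇒< (_ , _ , _ , c<top , _) (_ , _ , bottom≤c′ , _) (level p) =
    <-≤-trans c<top (≤-trans (A-level-mono p) bottom≤c′)
  LexLess⇒< {a = a} (_ , _ , _ , _ , _ , c<next , _) (_ , _ , _ , _ , Ab′≤c′ , _)
            (exponent refl p) =
    <-≤-trans c<next (≤-trans (A-mono a p) Ab′≤c′)
  LexLess⇒< {c} {a} {b} {m} {n} {c′} {m′ = m′} {n′}
            (_ , c≡ , _ , _ , _ , _ , n<X) (_ , c′≡ , _) (coefficient refl refl p) = begin-strict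
    c             ≡⟨ c≡ ⟩
    X * m + n     <⟨ x*m+r<x*[1+m] X m n<X ⟩
    X * suc m     ≤⟨ *-monoʳ-≤ X p ⟩
    X * m′        ≤⟨ m≤m+n _ _ ⟩
    X * m′ + n′   ≡⟨ sym c′≡ ⟩
    c′            ∎
    where
    open ≤-Reasoning
    X = A a k b
  LexLess⇒< (_ , c≡ , _) (_ , c′≡ , _) (remainder refl refl refl p) =
    subst₂ _<_ (sym c≡) (sym c′≡) (+-monoʳ-< _ p)

  <⇒LexLess : IsNF k c a b m n → IsNF k c′ a′ b′ m′ n′ → c < c′ → LexLess a b m n a′ b′ m′ n′
  <⇒LexLess {a = a} {b} {m} {n} {a′ = a′} {b′} {m′} {n′} nf@(_ , c≡ , _) nf′@(_ , c′≡ , _) c<c′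
    with lex-compare a b m n a′ b′ m′ n′
  ... | lex< l                 = l
  ... | lex> l                 = ⊥-elim (<-asym c<c′ (LexLess⇒< nf′ nf l))
  ... | lex≡ refl refl refl refl = ⊥-elim (<-irrefl (trans c≡ (sym c′≡)) c<c′)

  nf-unique : IsNF k c a b m n → IsNF k c a′ b′ m′ n′ → a ≡ a′ × b ≡ b′ × m ≡ m′ × n ≡ n′
  nf-unique {a = a} {b} {m} {n} {a′} {b′} {m′} {n′} nf nf′ with lex-compare a b m n a′ b′ m′ n′
  ... | lex< l           = ⊥-elim (<-irrefl refl (LexLess⇒< nf nf′ l))
  ... | lex> l           = ⊥-elim (<-irrefl refl (LexLess⇒< nf′ nf l))
  ... | lex≡ e₁ e₂ e₃ e₄ = e₁ , e₂ , e₃ , e₄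

  nf-rec : (P : ℕ → Set) → P 0 → (∀ {c} a b m n → IsNF k c a b m n → P b → P n → P c) →
           ∀ c → P c
  nf-rec P P0 step = <-rec P go
    where
    go : ∀ c → (∀ {d} → d < c → P d) → P c
    go zero    _  = P0
    go (suc c) ih with nf-exists z<s
    ... | a , b , m , n , nf =
      step a b m n nf (ih (nf-b< {a = a} {b} {m} nf)) (ih (nf-n< {a = a} {b} {m} nf))

  baseChange-total : ∀ c → ∃[ c′ ] BaseChange k c c′
  baseChange-total = nf-rec (λ c → ∃[ c′ ] BaseChange k c c′) (0 , bc-zero)
    (λ a b m n nf (_ , Db) (_ , Dn) → _ , bc-nf {a = a} {b} {m} nf Db Dn)

  psi-total : ∀ c → ∃[ α ] Psi k c α
  psi-total = nf-rec (λ c → ∃[ α ] Psi k c α) (𝟎 , ψ-zero)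
    (λ a b m n nf (_ , ψb) (_ , ψn) → _ , ψ-nf {a = a} {b} {m} nf ψb ψn)

  baseChange-functional : BaseChange k c c′ → BaseChange k c d′ → c′ ≡ d′
  baseChange-functional bc-zero            bc-zero                = refl
  baseChange-functional bc-zero            (bc-nf (() , _) _ _)
  baseChange-functional (bc-nf (() , _) _ _) bc-zero
  baseChange-functional (bc-nf {a = a} {b} {m} {n} nf Db Dn)
                        (bc-nf {a = a′} {b′} {m′} {n′} nf′ Db′ Dn′)
    with nf-unique {a = a} {b} {m} {n} {a′} {b′} {m′} {n′} nf nf′
  ... | refl , refl , refl , refl =
    cong₂ (λ b″ n″ → A a (suc k) b″ * m + n″)
          (baseChange-functional Db Db′) (baseChange-functional Dn Dn′)

  psi-functional : ∀ {α β} → Psi k c α → Psi k c β → α ≡ β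
  psi-functional ψ-zero             ψ-zero                = refl
  psi-functional ψ-zero             (ψ-nf (() , _) _ _)
  psi-functional (ψ-nf (() , _) _ _) ψ-zero
  psi-functional (ψ-nf {a = a} {b} {m} {n} nf ψb ψn)
                 (ψ-nf {a = a′} {b′} {m′} {n′} nf′ ψb′ ψn′)
    with nf-unique {a = a} {b} {m} {n} {a′} {b′} {m′} {n′} nf nf′
  ... | refl , refl , refl , refl =
    cong₂ (λ β ν → ωexp (ε a ⊕ β) ⊗ℕ m ⊕ ν) (psi-functional ψb ψb′) (psi-functional ψn ψn′)

-- Base change k ↦ k+1 preserves normal forms

tower : ℕ → ℕ → ℕ → ℕ
tower k a i = iter i (A a k) 0

module Preservation {k : ℕ} (1<k : 1 < k) where
  private
    K : ℕ
    K = suc k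
  open Growth 1<k
  open NormalForm 1<k
  module G⁺ = Growth (m<n⇒m<1+n 1<k)
  module NF⁺ = NormalForm (m<n⇒m<1+n 1<k)

  A-baseChange-≤ : ∀ a → b ≤ b′ → A a k b ≤ A a K b′
  A-baseChange-≤ a b≤b′ = ≤-trans (A-monoˡ-base 1<k a _) (G⁺.A-mono a b≤b′)

  -- Keeps c′ below A_{a+1}(k+1,0) = A_a(k+1, A_a^k(k+1,0)): it is applied to the exponent b
  -- with i = k.
  TowerBounded : ℕ → ℕ → Set
  TowerBounded c c′ = ∀ a i → i ≤ k → c < tower k a i → c′ < tower K a i

  record Invariant (c : ℕ) : Set where
    field
      normal     : ∀ {a b m n b′ n′} → IsNF k c a b m n →
                   BaseChange k b b′ → BaseChange k n n′ → IsNF K (A a K b′ * m + n′) a b′ m n′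
      increasing : ∀ {c′} → BaseChange k c c′ → c ≤ c′
      bounded    : ∀ {c′} → BaseChange k c c′ → TowerBounded c c′
      monotone   : ∀ {d d′ c′} → d < c → BaseChange k d d′ → BaseChange k c c′ → d′ < c′

  open Invariant

  InvariantBelow : ℕ → Set
  InvariantBelow c = ∀ {d} → d < c → Invariant d

  level0-coefficient< : IsNF k c 0 b m n → m < k
  level0-coefficient< {c} {b} {m} {n} (_ , c≡ , _ , _ , _ , c<k*k^b , _) =
    ≰⇒> λ k≤m → <⇒≱ c<k*k^b (begin
      k * k ^ b       ≡⟨ *-comm k _ ⟩
      k ^ b * k       ≤⟨ *-monoʳ-≤ (k ^ b) k≤m ⟩
      k ^ b * m       ≤⟨ m≤m+n _ n ⟩
      k ^ b * m + n   ≡⟨ sym c≡ ⟩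
      c               ∎)
    where open ≤-Reasoning

  coefficient-room : IsNF k c a b m n → b ≤ b′ → A a K b′ * suc m ≤ A a K (suc b′)
  coefficient-room {a = zero} {b} {m} {b′ = b′} nf _ = begin
    K ^ b′ * suc m  ≤⟨ *-monoʳ-≤ (K ^ b′) (s≤s (<⇒≤ (level0-coefficient< {b = b} {m} nf))) ⟩
    K ^ b′ * K      ≡⟨ *-comm (K ^ b′) K ⟩
    K ^ suc b′      ∎
    where open ≤-Reasoning
  coefficient-room {a = suc a} {b} {m} {b′ = b′} nf@(_ , _ , _ , _ , _ , c<next , _) b≤b′ = begin
    Y * suc m  ≤⟨ *-mono-≤ (≤-iter (G⁺.A-inflationary a) k Y) m<z ⟩
    z * z      ≤⟨ A-square (s≤s 1<k) a z ⟩
    A a K z    ∎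
    where
    open ≤-Reasoning
    Y = A (suc a) K b′
    z = iter k (A a K) Y
    m<z : m < z
    m<z = ≤-<-trans (nf-m≤ {a = suc a} {b} nf) (<-≤-trans c<next
            (iter-pointwise-≤ (A-monoˡ-base 1<k a) (G⁺.A-mono a) k (A-baseChange-≤ (suc a) b≤b′)))

  -- If n > 0 then A_a(k,b) < c; apply monotonicity of the base change there to n < A_a(k,b).
  remainder-bound : InvariantBelow c → IsNF k c a b m n →
                    BaseChange k b b′ → BaseChange k n n′ → n′ < A a K b′
  remainder-bound {a = a} {b′ = b′} ih nf Db bc-zero = G⁺.A-positive a b′
  remainder-bound {c} {a} {b} {m} {n′ = n′} ih nf@(_ , c≡ , _ , _ , _ , _ , n<X) Db
                  Dn@(bc-nf (0<n , _) _ _) =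
    subst (n′ <_) (trans (+-identityʳ _) (*-identityʳ _))
      (monotone (ih X<c) n<X Dn (bc-nf {a = a} {b} {1} (nf-leading {a = a} {b} {m} nf) Db bc-zero))
    where
    X<c : A a k b < c
    X<c = subst (A a k b <_) (sym c≡) (x<x*m+r (A a k b) (nf-m>0 {a = a} {b} nf) 0<n)

  normal-step : InvariantBelow c → IsNF k c a b m n → BaseChange k b b′ → BaseChange k n n′ →
                IsNF K (A a K b′ * m + n′) a b′ m n′
  normal-step {a = a} {b} {m} {b′ = b′} {n′} ih nf@(_ , _ , _ , c<top , _) Db Dn =
    <-≤-trans (G⁺.A-positive a b′) Y≤c′ , refl , ≤-trans (G⁺.A-mono a z≤n) Y≤c′ ,
    c′<top , Y≤c′ , c′<next , n′<Y
    where
    b<c = nf-b< {a = a} {b} {m} nf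
    n′<Y = remainder-bound {a = a} {b} {m} ih nf Db Dn
    Y≤c′ = x≤x*m+r (A a K b′) n′ (nf-m>0 {a = a} {b} nf)
    c′<next : A a K b′ * m + n′ < A a K (suc b′)
    c′<next = <-≤-trans (x*m+r<x*[1+m] (A a K b′) m n′<Y)
                        (coefficient-room {a = a} {b} {m} nf (increasing (ih b<c) Db))
    b′<tower : b′ < tower K a k
    b′<tower = bounded (ih b<c) Db a k ≤-refl (<-trans b<c c<top)
    c′<top : A a K b′ * m + n′ < A (suc a) K 0
    c′<top = <-≤-trans c′<next (G⁺.A-mono a b′<tower)

  increasing-step : InvariantBelow c → BaseChange k c c′ → c ≤ c′
  increasing-step ih bc-zero = z≤n
  increasing-step ih (bc-nf {a = a} {b} {m} nf@(_ , c≡ , _) Db Dn) =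
    ≤-trans (≤-reflexive c≡)
      (+-mono-≤ (*-monoˡ-≤ m (A-baseChange-≤ a (increasing (ih (nf-b< {a = a} {b} {m} nf)) Db)))
                (increasing (ih (nf-n< {a = a} {b} {m} nf)) Dn))

  tower-bound : IsNF k c a b m n → IsNF K c′ a b′ m′ n′ →
                (∀ i → i ≤ k → b < tower k a i → b′ < tower K a i) → TowerBounded c c′
  tower-bound _ _ _ a₀ zero _ ()
  tower-bound {a = a} (_ , _ , Aa0≤c , _ , Ab≤c , _) (_ , _ , _ , c′<top , _ , c′<next , _)
              b-bounded a₀ (suc i) 1+i≤k c<tower with <-cmp a a₀
  ... | tri< a<a₀ _ _ = <-≤-trans c′<top (≤-trans (G⁺.A-level-mono a<a₀) (G⁺.A-mono a₀ z≤n))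
  ... | tri≈ _ refl _ =
    <-≤-trans c′<next (G⁺.A-mono a (b-bounded i (≤-trans (n≤1+n i) 1+i≤k)
                                     (mono⇒reflects-< (A-mono a) (≤-<-trans Ab≤c c<tower))))
  ... | tri> _ _ a₀<a = ⊥-elim (<⇒≱ c<tower
    (≤-trans (iter-monoˡ (A-inflationary a₀) (A-mono a₀) 1+i≤k 0)
             (≤-trans (A-level-mono a₀<a) Aa0≤c)))

  bounded-step : InvariantBelow c → BaseChange k c c′ → TowerBounded c c′
  bounded-step ih bc-zero a zero    _ ()
  bounded-step ih bc-zero a (suc i) _ _ = G⁺.A-positive a _
  bounded-step ih (bc-nf {a = a} {b} {m} nf Db Dn) =
    tower-bound {a = a} {b} {m} nf (normal-step {a = a} {b} {m} ih nf Db Dn)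
      (bounded (ih (nf-b< {a = a} {b} {m} nf)) Db a)

  monotone-step : InvariantBelow c → d < c → BaseChange k d d′ → BaseChange k c c′ → d′ < c′
  monotone-step ih d<c bc-zero Dc = <-≤-trans (≤-<-trans z≤n d<c) (increasing-step ih Dc)
  monotone-step ih () (bc-nf _ _ _) bc-zero
  monotone-step ih d<c (bc-nf {a = a₁} {b₁} {m₁} {n₁} nf₁ Db₁ Dn₁)
                       (bc-nf {a = a} {b} {m} {n} nf Db Dn) =
    NF⁺.LexLess⇒< (normal (ih d<c) {a₁} {b₁} {m₁} nf₁ Db₁ Dn₁)
                  (normal-step {a = a} {b} {m} ih nf Db Dn)
      (LexLess-map (λ b₁<b → monotone (ih (nf-b< {a = a} {b} {m} nf)) b₁<b Db₁ Db)
                   (λ { refl → baseChange-functional Db₁ Db })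
                   (λ n₁<n → monotone (ih (nf-n< {a = a} {b} {m} nf)) n₁<n Dn₁ Dn)
                   (<⇒LexLess {a = a₁} {b₁} {m₁} {n₁} {a′ = a} {b} {m} {n} nf₁ nf d<c))

  invariant : ∀ c → Invariant c
  invariant = <-rec Invariant λ c ih → record
    { normal     = λ {a} {b} {m} → normal-step {a = a} {b} {m} ih
    ; increasing = increasing-step ih
    ; bounded    = bounded-step ih
    ; monotone   = monotone-step ih
    }

  transfer : ∀ {α} → BaseChange k c c′ → Psi k c α → Psi K c′ α
  transfer bc-zero ψ-zero = ψ-zero
  transfer bc-zero (ψ-nf (() , _) _ _)
  transfer (bc-nf (() , _) _ _) ψ-zero
  transfer (bc-nf {a = a} {b} {m} {n} nf Db Dn) (ψ-nf {a = a₂} {b₂} {m₂} {n₂} nf₂ ψb ψn)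
    with nf-unique {a = a} {b} {m} {n} {a₂} {b₂} {m₂} {n₂} nf nf₂
  ... | refl , refl , refl , refl =
    ψ-nf {a = a} (normal (invariant _) {a} {b} {m} nf Db Dn) (transfer Db ψb) (transfer Dn ψn)

mainTheorem9 : (k : ℕ) → 2 ≤ k → (c : ℕ) →
    Σ ℕ (λ c' → Σ Ord (λ α →
      BaseChange k c c' × Psi k c α × Psi (suc k) c' α))
    × ((c' : ℕ) (α β : Ord) → BaseChange k c c' → Psi k c α →
         Psi (suc k) c' β → β ≡ α)
mainTheorem9 k 1<k c with NormalForm.baseChange-total 1<k c | NormalForm.psi-total 1<k c
... | c′ , Dc | α , ψc =
  (c′ , α , Dc , ψc , transfer Dc ψc) , λ _ _ _ D ψ ψ′ → NF⁺.psi-functional ψ′ (transfer D ψ)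
  where open Preservation 1<k
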